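{- Let $B\subset\{0,1\}^8$ be an $(8,128,2)$-code containing $00000000$ (i.e. the set of all even-weight words of length 8), let $C_8\subset\{0,1\}^8$ be an $(8,16,4)$-code containing $00000000$, and let $$L=\{(x,\;y,\;y+z)\mid x,y\in B,\ z\in C_8\}\subset\{0,1\}^{24}.$$ Then the characteristic function $\chi_L$ is a perfect coloring of the graph $\frac12 Q_{24}$ with parameters $((28,248)(8,268))$.
   Context: Binary words are vectors of $\mathbb{F}_2^n$ with addition mod 2; $(u,v,w)$ denotes concatenation. An $(n,M,d)$-code is a set of $M$ binary words of length $n$ whose pairwise Hamming distances are at least $d$. $\frac12 Q_{24}$ is the graph on binary words of length $24$ with an even number of ones, adjacent iff they differ in exactly two positions. $\chi_L$ is a perfect coloring with parameters $((a,b)(c,d))$ means every vertex of $L$ has exactly $a$ neighbours in $L$ and $b$ outside, and every vertex outside $L$ has exactly $c$ neighbours in $L$ and $d$ outside. -}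

module Defs where

open import Data.Bool using (Bool; true; false; _xor_; not; _∧_; if_then_else_)
open import Data.Nat using (ℕ; zero; suc; _≤_; _%_)
open import Data.Vec using (Vec; []; _∷_; zipWith; replicate; _++_)
open import Data.List using (List; []; _∷_; length; map; concatMap; filter)
open import Data.List.Relation.Unary.Any using (Any)
open import Data.List.Membership.Propositional using (_∈_)
open import Data.List.Relation.Unary.AllPairs using (AllPairs)
open import Data.Product using (Σ; ∃; _×_; _,_)
open import Relation.Nullary using (¬_)
open import Relation.Unary using (Pred; Decidable)
open import Relation.Binary.PropositionalEquality using (_≡_)

Word : ℕ → Set
Word n = Vec Bool n

weight : ∀ {n} → Word n → ℕ
weight [] = 0
weight (true ∷ w) = suc (weight w)
weight (false ∷ w) = weight w

_⊕_ : ∀ {n} → Word n → Word n → Word n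
_⊕_ = zipWith _xor_

dist : ∀ {n} → Word n → Word n → ℕ
dist u v = weight (u ⊕ v)

zeroWord : ∀ n → Word n
zeroWord n = replicate n false

allWords : ∀ n → List (Word n)
allWords zero = [] ∷ []
allWords (suc n) = map (false ∷_) (allWords n) Data.List.++ map (true ∷_) (allWords n)

-- an (n,M,d)-code: a list of M words with pairwise distances ≥ d
-- (for d ≥ 1 this forces the words to be distinct, so it is a set of M words)
record IsCode (n M d : ℕ) (C : List (Word n)) : Set where
  field
    size     : length C ≡ M
    distance : AllPairs (λ u v → d ≤ dist u v) C

-- vertices of ½Q_n: words of even weight
IsVertex : ∀ {n} → Word n → Set
IsVertex v = weight v % 2 ≡ 0

Adj : ∀ {n} → Word n → Word n → Set
Adj u v = dist u v ≡ 2

countNbrs : ∀ {n} (P : Pred (Word n) Agda.Primitive.lzero) → Decidable P → Word n → ℕ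
countNbrs {n} P P? v =
  length (filter (λ u → Data.Nat._≟_ (dist v u) 2 Relation.Nullary.×-dec P? u)
                 (filter (λ u → Data.Nat._≟_ (weight u % 2) 0) (allWords n)))

PerfectColoring : ∀ n (L : Pred (Word n) Agda.Primitive.lzero) → Decidable L → ℕ → ℕ → ℕ → ℕ → Set
PerfectColoring n L L? a b c d =
  (∀ v → IsVertex v → L v →
     countNbrs L L? v ≡ a × countNbrs (λ u → ¬ L u) (λ u → Relation.Nullary.¬? (L? u)) v ≡ b) ×
  (∀ v → IsVertex v → ¬ L v →
     countNbrs L L? v ≡ c × countNbrs (λ u → ¬ L u) (λ u → Relation.Nullary.¬? (L? u)) v ≡ d)

InL : List (Word 8) → List (Word 8) → Word 24 → Set
InL B C w = ∃ λ x → ∃ λ y → ∃ λ z → x ∈ B × y ∈ B × z ∈ C × w ≡ x ++ y ++ (y ⊕ z)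

module Submission where

-- B is the even-weight code: deleting the first coordinate maps it onto all of 𝔽₂⁷, and two words of B
-- whose tails differ in one place differ in exactly two places. C₈ is an extended perfect code: the balls
-- of radius one around its punctured words fill 𝔽₂⁷, which forces all codewords to be even, so an odd word
-- has exactly one codeword at distance one, a codeword has none at distance two, and, by double counting,
-- an even non-codeword has exactly four at distance two.
-- The neighbours of v = (x, y, z) in ½Q₂₄ are the v + e with e of weight two. Sorting the e by the weights
-- of their three blocks, the number of them with v + e ∈ L only depends on the parities of x and y and on
-- the word y + z, and these facts evaluate it to 28 when v ∈ L and to 8 otherwise; the counts outside L
-- follow because every vertex has 276 neighbours.

open import Defs
open import Data.Bool using (Bool; true; false; not; _xor_; _∧_; T; if_then_else_)
open import Data.Bool.Properties using (xor-assoc; xor-comm; xor-same; not-involutive; T-∧; T-not-≡)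
import Data.Bool.Properties as Boolₚ
open import Data.Nat using (ℕ; zero; suc; _+_; _*_; _^_; _%_; _≤_; _<_; z≤n; s≤s; s≤s⁻¹; _≤?_; _≡ᵇ_)
open import Data.Nat.Properties
open import Data.Nat.DivMod using ([m+n]%n≡m%n)
open import Data.Nat.ListAction using (sum)
open import Data.Nat.ListAction.Properties using (sum-++)
open import Data.Nat.Tactic.RingSolver using (solve-∀)
open import Data.List using (List; []; _∷_; map; length; concatMap; filter) renaming (_++_ to _++ₗ_)
open import Data.List.Properties using (map-++; map-∘; map-cong; map-cong-local; length-++; length-map; length-removeAt′)
open import Data.List.Membership.Propositional using (_∈_; _∉_; find)
open import Data.List.Membership.Propositional.Properties using (∈-map⁻; ∈-map⁺; ∈-++⁻; ∈-++⁺ˡ; ∈-++⁺ʳ; ∈-concatMap⁻)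
open import Data.List.Relation.Unary.All as All using (All; []; _∷_)
import Data.List.Relation.Unary.All.Properties as Allₚ
open import Data.List.Relation.Unary.Any as Any using (here; there; _─_)
open import Data.List.Relation.Unary.AllPairs as AllPairs using (AllPairs; []; _∷_)
import Data.List.Relation.Unary.AllPairs.Properties as AllPairsₚ
open import Data.Vec using ([]; _∷_; _++_; tail; take; drop)
open import Data.Vec.Properties using (≡-dec; take-zipWith; drop-zipWith; take++drop≡id; ++-injectiveˡ; ++-injectiveʳ)
open import Data.Product using (∃; _×_; _,_)
open import Data.Sum using (inj₁; inj₂)
open import Function using (_∘_; const; _⇔_; mk⇔; Equivalence)
open import Relation.Binary.Definitions using (DecidableEquality)
open import Relation.Binary.PropositionalEquality
open import Relation.Nullary using (¬_; ¬?; yes; no; does; contradiction)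
open import Relation.Nullary.Decidable using (does-⇔; dec-true; dec-false)
open import Relation.Nullary.Decidable.Core using (T?)
open import Relation.Unary using (Pred; Decidable)

-- Words

𝟙 : Bool → ℕ
𝟙 true = 1
𝟙 false = 0

𝟙-T : ∀ {b} → T b → 𝟙 b ≡ 1
𝟙-T {true} _ = refl

𝟙-¬T : ∀ {b} → ¬ T b → 𝟙 b ≡ 0
𝟙-¬T {false} _ = refl
𝟙-¬T {true} ¬t = contradiction _ ¬t

⊕-assoc : ∀ {n} (x y z : Word n) → (x ⊕ y) ⊕ z ≡ x ⊕ (y ⊕ z)
⊕-assoc [] [] [] = refl
⊕-assoc (a ∷ x) (b ∷ y) (c ∷ z) = cong₂ _∷_ (xor-assoc a b c) (⊕-assoc x y z)

⊕-comm : ∀ {n} (x y : Word n) → x ⊕ y ≡ y ⊕ x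
⊕-comm [] [] = refl
⊕-comm (a ∷ x) (b ∷ y) = cong₂ _∷_ (xor-comm a b) (⊕-comm x y)

⊕-identityˡ : ∀ {n} (x : Word n) → zeroWord n ⊕ x ≡ x
⊕-identityˡ [] = refl
⊕-identityˡ (b ∷ x) = cong (b ∷_) (⊕-identityˡ x)

⊕-identityʳ : ∀ {n} (x : Word n) → x ⊕ zeroWord n ≡ x
⊕-identityʳ x = trans (⊕-comm x _) (⊕-identityˡ x)

⊕-self : ∀ {n} (x : Word n) → x ⊕ x ≡ zeroWord n
⊕-self [] = refl
⊕-self (b ∷ x) = cong₂ _∷_ (xor-same b) (⊕-self x)

⊕-cancelˡ : ∀ {n} (x y : Word n) → x ⊕ (x ⊕ y) ≡ y
⊕-cancelˡ {n} x y = begin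
  x ⊕ (x ⊕ y)     ≡⟨ ⊕-assoc x x y ⟨
  (x ⊕ x) ⊕ y     ≡⟨ cong (_⊕ y) (⊕-self x) ⟩
  zeroWord n ⊕ y  ≡⟨ ⊕-identityˡ y ⟩
  y               ∎
  where open ≡-Reasoning

⊕-injectiveʳ : ∀ {n} (x : Word n) {y z : Word n} → x ⊕ y ≡ x ⊕ z → y ≡ z
⊕-injectiveʳ x {y} {z} eq = trans (sym (⊕-cancelˡ x y)) (trans (cong (x ⊕_) eq) (⊕-cancelˡ x z))

⊕-interchange : ∀ {n} (a b c d : Word n) → (a ⊕ b) ⊕ (c ⊕ d) ≡ (a ⊕ c) ⊕ (b ⊕ d)
⊕-interchange a b c d = begin
  (a ⊕ b) ⊕ (c ⊕ d)  ≡⟨ ⊕-assoc a b (c ⊕ d) ⟩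
  a ⊕ (b ⊕ (c ⊕ d))  ≡⟨ cong (a ⊕_) (⊕-assoc b c d) ⟨
  a ⊕ ((b ⊕ c) ⊕ d)  ≡⟨ cong (λ t → a ⊕ (t ⊕ d)) (⊕-comm b c) ⟩
  a ⊕ ((c ⊕ b) ⊕ d)  ≡⟨ cong (a ⊕_) (⊕-assoc c b d) ⟩
  a ⊕ (c ⊕ (b ⊕ d))  ≡⟨ ⊕-assoc a c (b ⊕ d) ⟨
  (a ⊕ c) ⊕ (b ⊕ d)  ∎
  where open ≡-Reasoning

parity : ∀ {n} → Word n → Bool
parity [] = false
parity (b ∷ w) = b xor parity w

odd : ℕ → Bool
odd zero = false
odd (suc n) = not (odd n)

xor≡false⇒≡ : ∀ {a b} → a xor b ≡ false → a ≡ b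
xor≡false⇒≡ {true} {true} _ = refl
xor≡false⇒≡ {false} {false} _ = refl

parity-⊕ : ∀ {n} (x y : Word n) → parity (x ⊕ y) ≡ parity x xor parity y
parity-⊕ [] [] = refl
parity-⊕ (a ∷ x) (b ∷ y) = begin
  (a xor b) xor parity (x ⊕ y)          ≡⟨ cong ((a xor b) xor_) (parity-⊕ x y) ⟩
  (a xor b) xor (parity x xor parity y) ≡⟨ xor-assoc a b _ ⟩
  a xor (b xor (parity x xor parity y)) ≡⟨ cong (a xor_) (xor-assoc b (parity x) (parity y)) ⟨
  a xor ((b xor parity x) xor parity y) ≡⟨ cong (λ t → a xor (t xor parity y)) (xor-comm b (parity x)) ⟩
  a xor ((parity x xor b) xor parity y) ≡⟨ cong (a xor_) (xor-assoc (parity x) b (parity y)) ⟩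
  a xor (parity x xor (b xor parity y)) ≡⟨ xor-assoc a (parity x) _ ⟨
  (a xor parity x) xor (b xor parity y) ∎
  where open ≡-Reasoning

parity-++ : ∀ {m n} (x : Word m) (y : Word n) → parity (x ++ y) ≡ parity x xor parity y
parity-++ [] y = refl
parity-++ (b ∷ x) y = trans (cong (b xor_) (parity-++ x y)) (sym (xor-assoc b (parity x) (parity y)))

parity≡odd∘weight : ∀ {n} (w : Word n) → parity w ≡ odd (weight w)
parity≡odd∘weight [] = refl
parity≡odd∘weight (true ∷ w) = cong not (parity≡odd∘weight w)
parity≡odd∘weight (false ∷ w) = parity≡odd∘weight w

%2≡𝟙∘odd : ∀ n → n % 2 ≡ 𝟙 (odd n)
%2≡𝟙∘odd zero = refl
%2≡𝟙∘odd (suc zero) = refl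
%2≡𝟙∘odd (suc (suc n)) = begin
  (2 + n) % 2          ≡⟨ cong (_% 2) (+-comm 2 n) ⟩
  (n + 2) % 2          ≡⟨ [m+n]%n≡m%n n 2 ⟩
  n % 2                ≡⟨ %2≡𝟙∘odd n ⟩
  𝟙 (odd n)            ≡⟨ cong 𝟙 (not-involutive (odd n)) ⟨
  𝟙 (not (not (odd n))) ∎
  where open ≡-Reasoning

weight%2≡𝟙∘parity : ∀ {n} (w : Word n) → weight w % 2 ≡ 𝟙 (parity w)
weight%2≡𝟙∘parity w = trans (%2≡𝟙∘odd (weight w)) (cong 𝟙 (sym (parity≡odd∘weight w)))

weight-zeroWord : ∀ n → weight (zeroWord n) ≡ 0
weight-zeroWord zero = refl
weight-zeroWord (suc n) = weight-zeroWord n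

parity-zeroWord : ∀ n → parity (zeroWord n) ≡ false
parity-zeroWord n = trans (parity≡odd∘weight (zeroWord n)) (cong odd (weight-zeroWord n))

weight≡0⇒zeroWord : ∀ {n} (w : Word n) → weight w ≡ 0 → w ≡ zeroWord n
weight≡0⇒zeroWord [] _ = refl
weight≡0⇒zeroWord (false ∷ w) eq = cong (false ∷_) (weight≡0⇒zeroWord w eq)

weight-⊕-≤ : ∀ {n} (x y : Word n) → weight (x ⊕ y) ≤ weight x + weight y
weight-⊕-≤ [] [] = z≤n
weight-⊕-≤ (true ∷ x) (true ∷ y) = ≤-trans (weight-⊕-≤ x y) (≤-trans (m≤n+m _ 1) (s≤s (+-monoʳ-≤ (weight x) (n≤1+n _))))
weight-⊕-≤ (true ∷ x) (false ∷ y) = s≤s (weight-⊕-≤ x y)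
weight-⊕-≤ (false ∷ x) (true ∷ y) = ≤-trans (s≤s (weight-⊕-≤ x y)) (≤-reflexive (sym (+-suc _ _)))
weight-⊕-≤ (false ∷ x) (false ∷ y) = weight-⊕-≤ x y

dist-sym : ∀ {n} (x y : Word n) → dist x y ≡ dist y x
dist-sym x y = cong weight (⊕-comm x y)

dist-self : ∀ {n} (x : Word n) → dist x x ≡ 0
dist-self {n} x = trans (cong weight (⊕-self x)) (weight-zeroWord n)

dist-⊕ʳ : ∀ {n} (x y : Word n) → dist x (x ⊕ y) ≡ weight y
dist-⊕ʳ x y = cong weight (⊕-cancelˡ x y)

dist-zeroWordʳ : ∀ {n} (x : Word n) → dist x (zeroWord n) ≡ weight x
dist-zeroWordʳ x = cong weight (⊕-identityʳ x)

dist-⊕ˡ : ∀ {n} (s x y : Word n) → dist (s ⊕ x) (s ⊕ y) ≡ dist x y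
dist-⊕ˡ s x y = cong weight (trans (⊕-interchange s x s y) (trans (cong (_⊕ (x ⊕ y)) (⊕-self s)) (⊕-identityˡ (x ⊕ y))))

dist-triangle : ∀ {n} (x y z : Word n) → dist x z ≤ dist x y + dist y z
dist-triangle x y z = subst (λ w → weight w ≤ dist x y + dist y z) telescope (weight-⊕-≤ (x ⊕ y) (y ⊕ z))
  where
  telescope : (x ⊕ y) ⊕ (y ⊕ z) ≡ x ⊕ z
  telescope = trans (⊕-assoc x y (y ⊕ z)) (cong (x ⊕_) (⊕-cancelˡ y z))

weight-≤-weight+dist : ∀ {n} (x y : Word n) → weight y ≤ weight x + dist x y
weight-≤-weight+dist x y = subst (λ w → weight w ≤ weight x + dist x y) (⊕-cancelˡ x y) (weight-⊕-≤ x (x ⊕ y))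

dist-∷ : ∀ {n} a b (x y : Word n) → dist (a ∷ x) (b ∷ y) ≡ 𝟙 (a xor b) + dist x y
dist-∷ true true x y = refl
dist-∷ true false x y = refl
dist-∷ false true x y = refl
dist-∷ false false x y = refl

dist-∷-≤ : ∀ {n} a b (x y : Word n) → dist (a ∷ x) (b ∷ y) ≤ suc (dist x y)
dist-∷-≤ a b x y = subst (_≤ suc (dist x y)) (sym (dist-∷ a b x y)) (+-monoˡ-≤ (dist x y) (𝟙≤1 (a xor b)))
  where
  𝟙≤1 : ∀ c → 𝟙 c ≤ 1
  𝟙≤1 true = ≤-refl
  𝟙≤1 false = z≤n

dist-∷-≤1 : ∀ {n} a b (x : Word n) → dist (a ∷ x) (b ∷ x) ≤ 1
dist-∷-≤1 a b x = subst (λ k → dist (a ∷ x) (b ∷ x) ≤ suc k) (dist-self x) (dist-∷-≤ a b x x)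

dist-∷-≡ : ∀ {n k} a b (x y : Word n) → suc k ≤ dist (a ∷ x) (b ∷ y) → dist x y ≤ k → dist (a ∷ x) (b ∷ y) ≡ suc k
dist-∷-≡ a b x y lower upper = ≤-antisym (≤-trans (dist-∷-≤ a b x y) (s≤s upper)) lower

parity-⊕≡odd∘dist : ∀ {n} (x y : Word n) → parity x xor parity y ≡ odd (dist x y)
parity-⊕≡odd∘dist x y = trans (sym (parity-⊕ x y)) (parity≡odd∘weight (x ⊕ y))

even-dist⇒parity-≡ : ∀ {n} (x y : Word n) → odd (dist x y) ≡ false → parity x ≡ parity y
even-dist⇒parity-≡ x y even = xor≡false⇒≡ (trans (parity-⊕≡odd∘dist x y) even)

odd∧≤2⇒≡1 : ∀ {n} → odd n ≡ true → n ≤ 2 → n ≡ 1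
odd∧≤2⇒≡1 {1} _ _ = refl
odd∧≤2⇒≡1 {suc (suc (suc n))} _ (s≤s (s≤s ()))

clearBit : ∀ {n} (w : Word n) {m} → weight w ≡ suc m → ∃ λ v → weight v ≡ m × dist w v ≡ 1
clearBit (true ∷ w) eq = (false ∷ w) , suc-injective eq , cong suc (dist-self w)
clearBit (false ∷ w) eq with clearBit w eq
... | v , wv , dv = (false ∷ v) , wv , dv

clearTwoBits : ∀ {n} (w : Word n) {m} → weight w ≡ suc (suc m) → ∃ λ v → weight v ≡ m × dist w v ≤ 2
clearTwoBits w eq with clearBit w eq
... | u , wu , w~u with clearBit u wu
... | v , wv , u~v = v , wv , subst (dist w v ≤_) (cong₂ _+_ w~u u~v) (dist-triangle w u v)

-- Counting by sums

∑ : {A : Set} → List A → (A → ℕ) → ℕ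
∑ xs f = sum (map f xs)

module _ {A : Set} where

  ∑-++ : (xs ys : List A) (f : A → ℕ) → ∑ (xs ++ₗ ys) f ≡ ∑ xs f + ∑ ys f
  ∑-++ xs ys f = trans (cong sum (map-++ f xs ys)) (sum-++ (map f xs) (map f ys))

  ∑-cong : (xs : List A) {f g : A → ℕ} → (∀ x → f x ≡ g x) → ∑ xs f ≡ ∑ xs g
  ∑-cong xs f≗g = cong sum (map-cong f≗g xs)

  ∑-cong-∈ : (xs : List A) {f g : A → ℕ} → (∀ {x} → x ∈ xs → f x ≡ g x) → ∑ xs f ≡ ∑ xs g
  ∑-cong-∈ xs f≗g = cong sum (map-cong-local (All.tabulate f≗g))

  ∑-const : (xs : List A) (k : ℕ) → ∑ xs (const k) ≡ length xs * k
  ∑-const [] k = refl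
  ∑-const (x ∷ xs) k = cong (k +_) (∑-const xs k)

  ∑-𝟙+∑-𝟙∘not : (xs : List A) (b : A → Bool) → ∑ xs (𝟙 ∘ b) + ∑ xs (𝟙 ∘ not ∘ b) ≡ length xs
  ∑-𝟙+∑-𝟙∘not [] b = refl
  ∑-𝟙+∑-𝟙∘not (x ∷ xs) b with b x
  ... | true = cong suc (∑-𝟙+∑-𝟙∘not xs b)
  ... | false = trans (+-suc _ _) (cong suc (∑-𝟙+∑-𝟙∘not xs b))

  length-filter≡∑ : {P : A → Set} (P? : Decidable P) (xs : List A) → length (filter P? xs) ≡ ∑ xs (𝟙 ∘ does ∘ P?)
  length-filter≡∑ P? [] = refl
  length-filter≡∑ P? (x ∷ xs) with does (P? x)
  ... | true = cong suc (length-filter≡∑ P? xs)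
  ... | false = length-filter≡∑ P? xs

  length-concatMap≡∑ : {B : Set} (f : A → List B) (xs : List A) → length (concatMap f xs) ≡ ∑ xs (length ∘ f)
  length-concatMap≡∑ f [] = refl
  length-concatMap≡∑ f (x ∷ xs) = trans (length-++ (f x)) (cong (length (f x) +_) (length-concatMap≡∑ f xs))

  ∑-+ : (xs : List A) (f g : A → ℕ) → ∑ xs (λ x → f x + g x) ≡ ∑ xs f + ∑ xs g
  ∑-+ [] f g = refl
  ∑-+ (x ∷ xs) f g = trans (cong (f x + g x +_) (∑-+ xs f g)) (interchange (f x) (g x) (∑ xs f) (∑ xs g))
    where
    interchange : ∀ a b c d → (a + b) + (c + d) ≡ (a + c) + (b + d)
    interchange = solve-∀

  ∑-𝟙-none : (xs : List A) (f : A → Bool) → (∀ {x} → x ∈ xs → ¬ T (f x)) → ∑ xs (𝟙 ∘ f) ≡ 0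
  ∑-𝟙-none xs f none = trans (∑-cong-∈ xs (𝟙-¬T ∘ none)) (trans (∑-const xs 0) (*-zeroʳ (length xs)))

  ∑-𝟙-unique : {xs : List A} (f : A → Bool) → AllPairs _≢_ xs → ∀ {x₀} → x₀ ∈ xs → T (f x₀) →
               (∀ {x y} → x ∈ xs → y ∈ xs → T (f x) → T (f y) → x ≡ y) → ∑ xs (𝟙 ∘ f) ≡ 1
  ∑-𝟙-unique {x ∷ xs} f (x∉xs ∷ _) (here refl) fx unique =
    cong₂ _+_ (𝟙-T fx) (∑-𝟙-none xs f λ y∈xs fy → All.lookup x∉xs y∈xs (unique (here refl) (there y∈xs) fx fy))
  ∑-𝟙-unique {x ∷ xs} f (x∉xs ∷ distinct) (there x₀∈xs) fx₀ unique =
    cong₂ _+_ (𝟙-¬T λ fx → All.lookup x∉xs x₀∈xs (unique (here refl) (there x₀∈xs) fx fx₀))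
              (∑-𝟙-unique f distinct x₀∈xs fx₀ λ x∈ y∈ → unique (there x∈) (there y∈))

∑-map : {A B : Set} (g : A → B) (xs : List A) (f : B → ℕ) → ∑ (map g xs) f ≡ ∑ xs (f ∘ g)
∑-map g xs f = cong sum (sym (map-∘ xs))

∑-∷-split : ∀ {n} (xs ys : List (Word n)) (f : Word (suc n) → ℕ) →
            ∑ (map (false ∷_) xs ++ₗ map (true ∷_) ys) f ≡ ∑ xs (f ∘ (false ∷_)) + ∑ ys (f ∘ (true ∷_))
∑-∷-split xs ys f = trans (∑-++ (map (false ∷_) xs) (map (true ∷_) ys) f) (cong₂ _+_ (∑-map (false ∷_) xs f) (∑-map (true ∷_) ys f))

-- All words, and the words of a fixed weight

∈-allWords : ∀ {n} (w : Word n) → w ∈ allWords n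
∈-allWords [] = here refl
∈-allWords {suc n} (false ∷ w) = ∈-++⁺ˡ (∈-map⁺ (false ∷_) (∈-allWords w))
∈-allWords {suc n} (true ∷ w) = ∈-++⁺ʳ (map (false ∷_) (allWords n)) (∈-map⁺ (true ∷_) (∈-allWords w))

length-allWords : ∀ n → length (allWords n) ≡ 2 ^ n
length-allWords zero = refl
length-allWords (suc n) = begin
  length (map (false ∷_) (allWords n) ++ₗ map (true ∷_) (allWords n))  ≡⟨ length-++ (map (false ∷_) (allWords n)) ⟩
  length (map (false ∷_) (allWords n)) + length (map (true ∷_) (allWords n))
    ≡⟨ cong₂ _+_ (length-map (false ∷_) (allWords n)) (length-map (true ∷_) (allWords n)) ⟩
  length (allWords n) + length (allWords n)  ≡⟨ cong₂ _+_ (length-allWords n) (length-allWords n) ⟩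
  2 ^ n + 2 ^ n                              ≡⟨ cong (2 ^ n +_) (+-identityʳ (2 ^ n)) ⟨
  2 ^ suc n                                  ∎
  where open ≡-Reasoning

∑-allWords-translate : ∀ n (v : Word n) (f : Word n → ℕ) → ∑ (allWords n) f ≡ ∑ (allWords n) (f ∘ (v ⊕_))
∑-allWords-translate zero [] f = refl
∑-allWords-translate (suc n) (b ∷ v) f = begin
  ∑ (allWords (suc n)) f                                                ≡⟨ ∑-∷-split W W f ⟩
  ∑ W (f ∘ (false ∷_)) + ∑ W (f ∘ (true ∷_))                            ≡⟨ halves b ⟩
  ∑ W (λ x → f ((b xor false) ∷ (v ⊕ x))) + ∑ W (λ x → f ((b xor true) ∷ (v ⊕ x)))
    ≡⟨ ∑-∷-split W W (f ∘ ((b ∷ v) ⊕_)) ⟨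
  ∑ (allWords (suc n)) (f ∘ ((b ∷ v) ⊕_))                               ∎
  where
  open ≡-Reasoning
  W = allWords n
  translate : ∀ c → ∑ W (f ∘ (c ∷_)) ≡ ∑ W (λ x → f (c ∷ (v ⊕ x)))
  translate c = ∑-allWords-translate n v (f ∘ (c ∷_))
  halves : ∀ b → ∑ W (f ∘ (false ∷_)) + ∑ W (f ∘ (true ∷_)) ≡
                 ∑ W (λ x → f ((b xor false) ∷ (v ⊕ x))) + ∑ W (λ x → f ((b xor true) ∷ (v ⊕ x)))
  halves false = cong₂ _+_ (translate false) (translate true)
  halves true = trans (+-comm (∑ W (f ∘ (false ∷_))) _) (cong₂ _+_ (translate true) (translate false))

ofWeight : ℕ → (n : ℕ) → List (Word n)
ofWeight zero n = zeroWord n ∷ []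
ofWeight (suc k) zero = []
ofWeight (suc k) (suc n) = map (false ∷_) (ofWeight (suc k) n) ++ₗ map (true ∷_) (ofWeight k n)

∈-ofWeight⁻ : ∀ k n {w : Word n} → w ∈ ofWeight k n → weight w ≡ k
∈-ofWeight⁻ zero n (here refl) = weight-zeroWord n
∈-ofWeight⁻ (suc k) (suc n) w∈ with ∈-++⁻ (map (false ∷_) (ofWeight (suc k) n)) w∈
... | inj₁ w∈₀ with ∈-map⁻ (false ∷_) w∈₀
...   | _ , v∈ , refl = ∈-ofWeight⁻ (suc k) n v∈
∈-ofWeight⁻ (suc k) (suc n) w∈ | inj₂ w∈₁ with ∈-map⁻ (true ∷_) w∈₁
...   | _ , v∈ , refl = cong suc (∈-ofWeight⁻ k n v∈)

∈-ofWeight⁺ : ∀ {n} (w : Word n) → w ∈ ofWeight (weight w) n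
∈-ofWeight⁺ [] = here refl
∈-ofWeight⁺ (true ∷ w) = ∈-++⁺ʳ (map (false ∷_) _) (∈-map⁺ (true ∷_) (∈-ofWeight⁺ w))
∈-ofWeight⁺ (false ∷ w) with weight w | ∈-ofWeight⁺ w
... | zero  | here refl = here refl
... | suc k | w∈ = ∈-++⁺ˡ (∈-map⁺ (false ∷_) w∈)

parity-ofWeight : ∀ {k n} {d : Word n} → d ∈ ofWeight k n → parity d ≡ odd k
parity-ofWeight {k} {n} {d} d∈ = trans (parity≡odd∘weight d) (cong odd (∈-ofWeight⁻ k n d∈))

length-ofWeight₁ : ∀ n → length (ofWeight 1 n) ≡ n
length-ofWeight₁ zero = refl
length-ofWeight₁ (suc n) = begin
  length (map (false ∷_) (ofWeight 1 n) ++ₗ (true ∷ zeroWord n) ∷ [])  ≡⟨ length-++ (map (false ∷_) (ofWeight 1 n)) ⟩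
  length (map (false ∷_) (ofWeight 1 n)) + 1                           ≡⟨ cong (_+ 1) (trans (length-map _ (ofWeight 1 n)) (length-ofWeight₁ n)) ⟩
  n + 1                                                                 ≡⟨ +-comm n 1 ⟩
  suc n                                                                 ∎
  where open ≡-Reasoning

ofWeight-distinct : ∀ k n → AllPairs _≢_ (ofWeight k n)
ofWeight-distinct zero n = [] ∷ []
ofWeight-distinct (suc k) zero = []
ofWeight-distinct (suc k) (suc n) =
  AllPairsₚ.++⁺ (prefix-distinct false (ofWeight-distinct (suc k) n)) (prefix-distinct true (ofWeight-distinct k n))
                (All.tabulate λ x∈ → All.tabulate λ y∈ → heads-differ x∈ y∈)
  where
  prefix-distinct : ∀ b {xs : List (Word n)} → AllPairs _≢_ xs → AllPairs _≢_ (map (b ∷_) xs)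
  prefix-distinct b distinct = AllPairsₚ.map⁺ (AllPairs.map (λ x≢y → x≢y ∘ cong tail) distinct)
  heads-differ : ∀ {xs ys : List (Word n)} {x y} → x ∈ map (false ∷_) xs → y ∈ map (true ∷_) ys → x ≢ y
  heads-differ x∈ y∈ with ∈-map⁻ (false ∷_) x∈ | ∈-map⁻ (true ∷_) y∈
  ... | _ , _ , refl | _ , _ , refl = λ ()

∑-allWords-weight≡ : ∀ k n (h : Word n → ℕ) →
  ∑ (allWords n) (λ e → if weight e ≡ᵇ k then h e else 0) ≡ ∑ (ofWeight k n) h
∑-allWords-weight≡ zero zero h = refl
∑-allWords-weight≡ (suc k) zero h = refl
∑-allWords-weight≡ zero (suc n) h =
  trans (∑-∷-split (allWords n) (allWords n) _)
        (trans (cong₂ _+_ (∑-allWords-weight≡ zero n (h ∘ (false ∷_)))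
                          (trans (∑-const (allWords n) 0) (*-zeroʳ (length (allWords n)))))
               (+-identityʳ _))
∑-allWords-weight≡ (suc k) (suc n) h =
  trans (∑-∷-split (allWords n) (allWords n) _)
        (trans (cong₂ _+_ (∑-allWords-weight≡ (suc k) n (h ∘ (false ∷_))) (∑-allWords-weight≡ k n (h ∘ (true ∷_))))
               (sym (∑-∷-split (ofWeight (suc k) n) (ofWeight k n) h)))

∑-ofWeight-∷ : ∀ k n (f : Word (suc n) → ℕ) →
  ∑ (ofWeight (suc k) (suc n)) f ≡ ∑ (ofWeight (suc k) n) (f ∘ (false ∷_)) + ∑ (ofWeight k n) (f ∘ (true ∷_))
∑-ofWeight-∷ k n = ∑-∷-split (ofWeight (suc k) n) (ofWeight k n)

∑∑ : ∀ {m n} → List (Word m) → List (Word n) → (Word (m + n) → ℕ) → ℕ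
∑∑ xs ys h = ∑ xs (λ x → ∑ ys (λ y → h (x ++ y)))

∑-ofWeight₀-++ : ∀ m n (h : Word (m + n) → ℕ) → ∑ (ofWeight 0 (m + n)) h ≡ ∑∑ (ofWeight 0 m) (ofWeight 0 n) h
∑-ofWeight₀-++ zero n h = sym (+-identityʳ _)
∑-ofWeight₀-++ (suc m) n h = ∑-ofWeight₀-++ m n (h ∘ (false ∷_))

∑-ofWeight₁-++ : ∀ m n (h : Word (m + n) → ℕ) →
  ∑ (ofWeight 1 (m + n)) h ≡ ∑∑ (ofWeight 1 m) (ofWeight 0 n) h + ∑∑ (ofWeight 0 m) (ofWeight 1 n) h
∑-ofWeight₁-++ zero n h = sym (+-identityʳ _)
∑-ofWeight₁-++ (suc m) n h = begin
  ∑ (ofWeight 1 (suc m + n)) h                        ≡⟨ ∑-ofWeight-∷ 0 (m + n) h ⟩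
  ∑ (ofWeight 1 (m + n)) h₀ + ∑ (ofWeight 0 (m + n)) h₁ ≡⟨ cong₂ _+_ (∑-ofWeight₁-++ m n h₀) (∑-ofWeight₀-++ m n h₁) ⟩
  (S₁₀ h₀ + S₀₁ h₀) + S₀₀ h₁                          ≡⟨ regroup (S₁₀ h₀) (S₀₁ h₀) (S₀₀ h₁) ⟩
  (S₁₀ h₀ + S₀₀ h₁) + S₀₁ h₀                          ≡⟨ cong (_+ S₀₁ h₀) (∑-ofWeight-∷ 0 m _) ⟨
  ∑∑ (ofWeight 1 (suc m)) (ofWeight 0 n) h + ∑∑ (ofWeight 0 (suc m)) (ofWeight 1 n) h ∎
  where
  open ≡-Reasoning
  h₀ h₁ : Word (m + n) → ℕ
  h₀ = h ∘ (false ∷_)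
  h₁ = h ∘ (true ∷_)
  S₁₀ S₀₁ S₀₀ : (Word (m + n) → ℕ) → ℕ
  S₁₀ = ∑∑ (ofWeight 1 m) (ofWeight 0 n)
  S₀₁ = ∑∑ (ofWeight 0 m) (ofWeight 1 n)
  S₀₀ = ∑∑ (ofWeight 0 m) (ofWeight 0 n)
  regroup : ∀ a b c → (a + b) + c ≡ (a + c) + b
  regroup = solve-∀

∑-ofWeight₂-++ : ∀ m n (h : Word (m + n) → ℕ) →
  ∑ (ofWeight 2 (m + n)) h ≡
  ∑∑ (ofWeight 2 m) (ofWeight 0 n) h + (∑∑ (ofWeight 1 m) (ofWeight 1 n) h + ∑∑ (ofWeight 0 m) (ofWeight 2 n) h)
∑-ofWeight₂-++ zero n h = sym (+-identityʳ _)
∑-ofWeight₂-++ (suc m) n h = begin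
  ∑ (ofWeight 2 (suc m + n)) h
    ≡⟨ ∑-ofWeight-∷ 1 (m + n) h ⟩
  ∑ (ofWeight 2 (m + n)) h₀ + ∑ (ofWeight 1 (m + n)) h₁
    ≡⟨ cong₂ _+_ (∑-ofWeight₂-++ m n h₀) (∑-ofWeight₁-++ m n h₁) ⟩
  (S₂₀ h₀ + (S₁₁ h₀ + S₀₂ h₀)) + (S₁₀ h₁ + S₀₁ h₁)
    ≡⟨ regroup (S₂₀ h₀) (S₁₁ h₀) (S₀₂ h₀) (S₁₀ h₁) (S₀₁ h₁) ⟩
  (S₂₀ h₀ + S₁₀ h₁) + ((S₁₁ h₀ + S₀₁ h₁) + S₀₂ h₀)
    ≡⟨ cong₂ _+_ (∑-ofWeight-∷ 1 m _) (cong₂ _+_ (∑-ofWeight-∷ 0 m _) refl) ⟨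
  ∑∑ (ofWeight 2 (suc m)) (ofWeight 0 n) h + (∑∑ (ofWeight 1 (suc m)) (ofWeight 1 n) h + ∑∑ (ofWeight 0 (suc m)) (ofWeight 2 n) h)
    ∎
  where
  open ≡-Reasoning
  h₀ h₁ : Word (m + n) → ℕ
  h₀ = h ∘ (false ∷_)
  h₁ = h ∘ (true ∷_)
  S₂₀ S₁₁ S₀₂ S₁₀ S₀₁ : (Word (m + n) → ℕ) → ℕ
  S₂₀ = ∑∑ (ofWeight 2 m) (ofWeight 0 n)
  S₁₁ = ∑∑ (ofWeight 1 m) (ofWeight 1 n)
  S₀₂ = ∑∑ (ofWeight 0 m) (ofWeight 2 n)
  S₁₀ = ∑∑ (ofWeight 1 m) (ofWeight 0 n)
  S₀₁ = ∑∑ (ofWeight 0 m) (ofWeight 1 n)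
  regroup : ∀ a c e b d → (a + (c + e)) + (b + d) ≡ (a + b) + ((c + d) + e)
  regroup = solve-∀

∑-ofWeight₁-⊕ : ∀ n (f : Word n → ℕ) →
  ∑ (ofWeight 1 n) (λ u → ∑ (ofWeight 1 n) (λ u' → f (u ⊕ u'))) ≡ n * f (zeroWord n) + 2 * ∑ (ofWeight 2 n) f
∑-ofWeight₁-⊕ zero f = refl
∑-ofWeight₁-⊕ (suc n) f = begin
  ∑ W₁' (λ u → ∑ W₁' (λ u' → f (u ⊕ u')))
    ≡⟨ ∑-ofWeight-∷ 0 n _ ⟩
  ∑ W₁ (λ x → ∑ W₁' (λ u' → f ((false ∷ x) ⊕ u'))) + (∑ W₁' (λ u' → f ((true ∷ z) ⊕ u')) + 0)
    ≡⟨ cong₂ _+_ (∑-cong W₁ λ x → ∑-ofWeight-∷ 0 n _) (cong (_+ 0) (∑-ofWeight-∷ 0 n _)) ⟩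
  ∑ W₁ (λ x → ∑ W₁ (λ x' → f₀ (x ⊕ x')) + (f₁ (x ⊕ z) + 0)) + ((∑ W₁ (λ x' → f₁ (z ⊕ x')) + (f₀ (z ⊕ z) + 0)) + 0)
    ≡⟨ cong (_+ ((∑ W₁ (λ x' → f₁ (z ⊕ x')) + (f₀ (z ⊕ z) + 0)) + 0)) (∑-+ W₁ _ _) ⟩
  (∑ W₁ (λ x → ∑ W₁ (λ x' → f₀ (x ⊕ x'))) + ∑ W₁ (λ x → f₁ (x ⊕ z) + 0)) + ((∑ W₁ (λ x' → f₁ (z ⊕ x')) + (f₀ (z ⊕ z) + 0)) + 0)
    ≡⟨ cong₂ _+_ (cong₂ _+_ (∑-ofWeight₁-⊕ n f₀) (∑-cong W₁ λ x → trans (+-identityʳ _) (cong f₁ (⊕-identityʳ x))))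
                 (cong₂ (λ s t → (s + (f₀ t + 0)) + 0) (∑-cong W₁ (cong f₁ ∘ ⊕-identityˡ)) (⊕-self z)) ⟩
  ((n * f₀ z + 2 * ∑ W₂ f₀) + ∑ W₁ f₁) + ((∑ W₁ f₁ + (f₀ z + 0)) + 0)
    ≡⟨ arith n (f₀ z) (∑ W₂ f₀) (∑ W₁ f₁) ⟩
  suc n * f₀ z + 2 * (∑ W₂ f₀ + ∑ W₁ f₁)
    ≡⟨ cong (λ t → suc n * f₀ z + 2 * t) (∑-ofWeight-∷ 1 n f) ⟨
  suc n * f (zeroWord (suc n)) + 2 * ∑ (ofWeight 2 (suc n)) f
    ∎
  where
  open ≡-Reasoning
  z = zeroWord n
  W₁ = ofWeight 1 n
  W₂ = ofWeight 2 n
  W₁' = ofWeight 1 (suc n)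
  f₀ f₁ : Word n → ℕ
  f₀ = f ∘ (false ∷_)
  f₁ = f ∘ (true ∷_)
  arith : ∀ n a s₂ s₁ → ((n * a + 2 * s₂) + s₁) + ((s₁ + (a + 0)) + 0) ≡ suc n * a + 2 * (s₂ + s₁)
  arith = solve-∀

-- Neighbourhoods in the halved cube

∑-filter : {A : Set} {P : A → Set} (P? : Decidable P) (xs : List A) (f : A → ℕ) →
           ∑ (filter P? xs) f ≡ ∑ xs (λ x → if does (P? x) then f x else 0)
∑-filter P? [] f = refl
∑-filter P? (x ∷ xs) f with does (P? x)
... | true = cong (f x +_) (∑-filter P? xs f)
... | false = ∑-filter P? xs f

IsVertex⇒even : ∀ {n} (v : Word n) → IsVertex v → parity v ≡ false
IsVertex⇒even v v-even with parity v | weight%2≡𝟙∘parity v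
... | false | _ = refl
... | true | eq with () ← trans (sym eq) v-even

neighbour-term : ∀ {n} (g : Word n → Bool) {v : Word n} → parity v ≡ false → ∀ e →
  (if weight (v ⊕ e) % 2 ≡ᵇ 0 then 𝟙 ((dist v (v ⊕ e) ≡ᵇ 2) ∧ g (v ⊕ e)) else 0) ≡
  (if weight e ≡ᵇ 2 then 𝟙 (g (v ⊕ e)) else 0)
neighbour-term g {v} v-even e rewrite dist-⊕ʳ v e with weight e ≡ᵇ 2 in e≡2?
... | false with weight (v ⊕ e) % 2 ≡ᵇ 0
...   | true = refl
...   | false = refl
neighbour-term g {v} v-even e | true rewrite weight%2≡𝟙∘parity (v ⊕ e) | parity-⊕ v e | v-even
  | parity≡odd∘weight e | ≡ᵇ⇒≡ (weight e) 2 (subst T (sym e≡2?) _) = refl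

-- The filters of countNbrs compute to boolean tests, as does (m ≟ n) reduces to m ≡ᵇ n.
countNbrs≡∑ : ∀ {n} (P : Pred (Word n) _) (P? : Decidable P) (g : Word n → Bool) → (∀ u → does (P? u) ≡ g u) →
  ∀ v → IsVertex v → countNbrs P P? v ≡ ∑ (ofWeight 2 n) (λ e → 𝟙 (g (v ⊕ e)))
countNbrs≡∑ {n} P P? g P?≡g v v-vertex = begin
  countNbrs P P? v
    ≡⟨ length-filter≡∑ _ (filter (λ u → weight u % 2 ≟ 0) (allWords n)) ⟩
  ∑ (filter (λ u → weight u % 2 ≟ 0) (allWords n)) (λ u → 𝟙 ((dist v u ≡ᵇ 2) ∧ does (P? u)))
    ≡⟨ ∑-filter _ (allWords n) _ ⟩
  ∑ (allWords n) (λ u → if weight u % 2 ≡ᵇ 0 then 𝟙 ((dist v u ≡ᵇ 2) ∧ does (P? u)) else 0)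
    ≡⟨ ∑-cong (allWords n) (λ u → cong (λ b → if weight u % 2 ≡ᵇ 0 then 𝟙 ((dist v u ≡ᵇ 2) ∧ b) else 0) (P?≡g u)) ⟩
  ∑ (allWords n) (λ u → if weight u % 2 ≡ᵇ 0 then 𝟙 ((dist v u ≡ᵇ 2) ∧ g u) else 0)
    ≡⟨ ∑-allWords-translate n v _ ⟩
  ∑ (allWords n) (λ e → if weight (v ⊕ e) % 2 ≡ᵇ 0 then 𝟙 ((dist v (v ⊕ e) ≡ᵇ 2) ∧ g (v ⊕ e)) else 0)
    ≡⟨ ∑-cong (allWords n) (neighbour-term g (IsVertex⇒even v v-vertex)) ⟩
  ∑ (allWords n) (λ e → if weight e ≡ᵇ 2 then 𝟙 (g (v ⊕ e)) else 0)
    ≡⟨ ∑-allWords-weight≡ 2 n _ ⟩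
  ∑ (ofWeight 2 n) (λ e → 𝟙 (g (v ⊕ e)))
    ∎
  where open ≡-Reasoning

countNbrs-+-complement : ∀ {n} (P : Pred (Word n) _) (P? : Decidable P) v → IsVertex v →
  countNbrs P P? v + countNbrs (λ u → ¬ P u) (λ u → ¬? (P? u)) v ≡ length (ofWeight 2 n)
countNbrs-+-complement {n} P P? v v-vertex = begin
  countNbrs P P? v + countNbrs (λ u → ¬ P u) (λ u → ¬? (P? u)) v
    ≡⟨ cong₂ _+_ (countNbrs≡∑ P P? (does ∘ P?) (λ _ → refl) v v-vertex)
                 (countNbrs≡∑ (λ u → ¬ P u) (λ u → ¬? (P? u)) (not ∘ does ∘ P?) (λ _ → refl) v v-vertex) ⟩
  ∑ (ofWeight 2 n) (λ e → 𝟙 (does (P? (v ⊕ e)))) + ∑ (ofWeight 2 n) (λ e → 𝟙 (not (does (P? (v ⊕ e)))))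
    ≡⟨ ∑-𝟙+∑-𝟙∘not (ofWeight 2 n) (does ∘ P? ∘ (v ⊕_)) ⟩
  length (ofWeight 2 n)
    ∎
  where open ≡-Reasoning

-- Codes

_≟ʷ_ : ∀ {n} → DecidableEquality (Word n)
_≟ʷ_ = ≡-dec Boolₚ._≟_

_∈ᵇ_ : ∀ {n} → Word n → List (Word n) → Bool
w ∈ᵇ C = does (Any.any? (w ≟ʷ_) C)

∈ᵇ⇒∈ : ∀ {n} {w : Word n} {C} → T (w ∈ᵇ C) → w ∈ C
∈ᵇ⇒∈ {w = w} {C} with Any.any? (w ≟ʷ_) C
... | yes w∈C = λ _ → w∈C

∈⇒∈ᵇ : ∀ {n} {w : Word n} {C} → w ∈ C → T (w ∈ᵇ C)
∈⇒∈ᵇ {w = w} {C} w∈C with Any.any? (w ≟ʷ_) C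
... | yes _ = _
... | no w∉C = w∉C w∈C

module _ {A : Set} where

  ∈-─ : {x y : A} {ys : List A} (x∈ys : x ∈ ys) → y ∈ ys → y ≢ x → y ∈ (ys ─ x∈ys)
  ∈-─ (here refl) (here refl) y≢x = contradiction refl y≢x
  ∈-─ (here refl) (there y∈ys) _ = y∈ys
  ∈-─ (there x∈ys) (here refl) _ = here refl
  ∈-─ (there x∈ys) (there y∈ys) y≢x = there (∈-─ x∈ys y∈ys y≢x)

  distinct-⊆⇒length-≤ : {xs ys : List A} → AllPairs _≢_ xs → (∀ {x} → x ∈ xs → x ∈ ys) → length xs ≤ length ys
  distinct-⊆⇒length-≤ [] _ = z≤n
  distinct-⊆⇒length-≤ {x ∷ xs} {ys} (x∉xs ∷ distinct) xs⊆ys = begin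
    suc (length xs)                  ≤⟨ s≤s (distinct-⊆⇒length-≤ distinct xs⊆ys─x) ⟩
    suc (length (ys ─ xs⊆ys (here refl)))  ≡⟨ length-removeAt′ ys _ ⟨
    length ys                        ∎
    where
    open ≤-Reasoning
    xs⊆ys─x : ∀ {y} → y ∈ xs → y ∈ (ys ─ xs⊆ys (here refl))
    xs⊆ys─x y∈xs = ∈-─ (xs⊆ys (here refl)) (xs⊆ys (there y∈xs)) (All.lookup x∉xs y∈xs ∘ sym)

distinct-words-complete : ∀ {n} {xs : List (Word n)} → AllPairs _≢_ xs → 2 ^ n ≤ length xs → ∀ w → w ∈ xs
distinct-words-complete {n} {xs} distinct enough w with Any.any? (w ≟ʷ_) xs
... | yes w∈xs = w∈xs
... | no w∉xs = contradiction enough (<⇒≱ (≤-trans (distinct-⊆⇒length-≤ w∷xs-distinct (λ {u} _ → ∈-allWords u))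
                                                    (≤-reflexive (length-allWords n))))
  where
  w∷xs-distinct : AllPairs _≢_ (w ∷ xs)
  w∷xs-distinct = All.tabulate (λ u∈xs w≡u → w∉xs (subst (_∈ xs) (sym w≡u) u∈xs)) ∷ distinct

distinct⇒far : ∀ {n d} {C : List (Word n)} → AllPairs (λ u v → d ≤ dist u v) C →
               ∀ {x y} → x ∈ C → y ∈ C → x ≢ y → d ≤ dist x y
distinct⇒far _ (here refl) (here refl) x≢y = contradiction refl x≢y
distinct⇒far (x-far ∷ _) (here refl) (there y∈C) _ = All.lookup x-far y∈C
distinct⇒far {d = d} (y-far ∷ _) {x} {y} (there x∈C) (here refl) _ = subst (d ≤_) (dist-sym y x) (All.lookup y-far x∈C)
distinct⇒far (_ ∷ far) (there x∈C) (there y∈C) x≢y = distinct⇒far far x∈C y∈C x≢y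

close⇒≡ : ∀ {n d} {C : List (Word n)} → AllPairs (λ u v → d ≤ dist u v) C →
          ∀ {x y} → x ∈ C → y ∈ C → dist x y < d → x ≡ y
close⇒≡ far {x} {y} x∈C y∈C close with x ≟ʷ y
... | yes x≡y = x≡y
... | no x≢y = contradiction (distinct⇒far far x∈C y∈C x≢y) (<⇒≱ close)

module EvenWeightCode {n} {B : List (Word (suc n))} (B-code : IsCode (suc n) (2 ^ n) 2 B) (0∈B : zeroWord (suc n) ∈ B) where
  open IsCode B-code

  tails-distinct : AllPairs _≢_ (map tail B)
  tails-distinct = AllPairsₚ.map⁺ (AllPairs.map (λ {u} {v} → tails-differ {u} {v}) distance)
    where
    tails-differ : ∀ {u v : Word (suc n)} → 2 ≤ dist u v → tail u ≢ tail v
    tails-differ {a ∷ x} {b ∷ .x} far refl = <⇒≱ (s≤s (dist-∷-≤1 a b x)) far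

  tails-complete : ∀ p → ∃ λ b → (b ∷ p) ∈ B
  tails-complete p
    with ∈-map⁻ tail (distinct-words-complete tails-distinct (≤-reflexive (sym (trans (length-map tail B) size))) p)
  ... | (b ∷ .p) , b∷p∈B , refl = b , b∷p∈B

  even-by-tail-weight : ∀ m b p → weight p ≡ m → (b ∷ p) ∈ B → parity (b ∷ p) ≡ false
  even-by-tail-weight zero b p p≡0 b∷p∈B with weight≡0⇒zeroWord p p≡0
  ... | refl = trans (cong parity (close⇒≡ distance b∷p∈B 0∈B (s≤s (dist-∷-≤1 b false (zeroWord n))))) (parity-zeroWord (suc n))
  even-by-tail-weight (suc m) b p wp b∷p∈B with clearBit p wp
  ... | q , wq , p~q with tails-complete q
  ... | c , c∷q∈B = trans (even-dist⇒parity-≡ (b ∷ p) (c ∷ q) (cong odd dist≡2)) (even-by-tail-weight m c q wq c∷q∈B)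
    where
    dist≡2 : dist (b ∷ p) (c ∷ q) ≡ 2
    dist≡2 = dist-∷-≡ b c p q (distinct⇒far distance b∷p∈B c∷q∈B (λ { refl → 0≢1+n (trans (sym (dist-self p)) p~q) }))
                      (≤-reflexive p~q)

  ∈⇒even : ∀ {w} → w ∈ B → parity w ≡ false
  ∈⇒even {b ∷ p} = even-by-tail-weight (weight p) b p refl

  even⇒∈ : ∀ {w} → parity w ≡ false → w ∈ B
  even⇒∈ {b ∷ p} w-even with tails-complete p
  ... | c , c∷p∈B = subst (λ a → (a ∷ p) ∈ B) (trans (xor≡false⇒≡ (∈⇒even c∷p∈B)) (sym (xor≡false⇒≡ w-even))) c∷p∈B

ball : ∀ {m} → Word m → List (Word m)
ball {m} p = map (p ⊕_) (zeroWord m ∷ ofWeight 1 m)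

∈-ball⁻ : ∀ {m} (p : Word m) {x} → x ∈ ball p → dist p x ≤ 1
∈-ball⁻ {m} p x∈ with ∈-map⁻ (p ⊕_) x∈
... | d , here refl , refl = ≤-trans (≤-reflexive (trans (dist-⊕ʳ p d) (weight-zeroWord m))) z≤n
... | d , there d∈ , refl = ≤-reflexive (trans (dist-⊕ʳ p d) (∈-ofWeight⁻ 1 m d∈))

ball-distinct : ∀ {m} (p : Word m) → AllPairs _≢_ (ball p)
ball-distinct {m} p = AllPairsₚ.map⁺ (AllPairs.map (λ d≢d' → d≢d' ∘ ⊕-injectiveʳ p) (0∉W₁ ∷ ofWeight-distinct 1 m))
  where
  0∉W₁ : All (zeroWord m ≢_) (ofWeight 1 m)
  0∉W₁ = All.tabulate λ d∈ 0≡d → 0≢1+n (trans (sym (weight-zeroWord m)) (trans (cong weight 0≡d) (∈-ofWeight⁻ 1 m d∈)))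

length-ball : ∀ {m} (p : Word m) → length (ball p) ≡ suc m
length-ball {m} p = cong suc (trans (length-map (p ⊕_) (ofWeight 1 m)) (length-ofWeight₁ m))

punctured-perfect : ∀ {m M} {C : List (Word (suc m))} → IsCode (suc m) M 4 C → M * suc m ≡ 2 ^ m →
                    ∀ q → ∃ λ c → c ∈ C × dist (tail c) q ≤ 1
punctured-perfect {m} {M} {C} C-code packed q =
  let c , c∈C , q∈ball = find (∈-concatMap⁻ (ball ∘ tail) {xs = C}
                                (distinct-words-complete balls-distinct (≤-reflexive (sym balls-length)) q))
  in c , c∈C , ∈-ball⁻ (tail c) q∈ball
  where
  open IsCode C-code
  balls = concatMap (ball ∘ tail) C
  disjoint : ∀ {u v : Word (suc m)} → 4 ≤ dist u v → All (λ x → All (x ≢_) (ball (tail v))) (ball (tail u))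
  disjoint {a ∷ x} {b ∷ y} far = All.tabulate λ {p} p∈ → All.tabulate λ {p'} p'∈ p≡p' → <⇒≱ (begin-strict
    dist x y              ≤⟨ dist-triangle x p y ⟩
    dist x p + dist p y   ≤⟨ +-mono-≤ (∈-ball⁻ x p∈) (subst (_≤ 1) (dist-sym y p) (∈-ball⁻ y (subst (_∈ ball y) (sym p≡p') p'∈))) ⟩
    2                     <⟨ ≤-refl ⟩
    3                     ∎) (s≤s⁻¹ (≤-trans far (dist-∷-≤ a b x y)))
    where open ≤-Reasoning
  balls-distinct : AllPairs _≢_ balls
  balls-distinct = AllPairsₚ.concat⁺ (Allₚ.map⁺ (All.tabulate λ {c} _ → ball-distinct (tail c)))
                                     (AllPairsₚ.map⁺ (AllPairs.map (λ {u} {v} → disjoint {u} {v}) distance))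
  balls-length : length balls ≡ 2 ^ m
  balls-length = begin
    length balls                   ≡⟨ length-concatMap≡∑ (ball ∘ tail) C ⟩
    ∑ C (length ∘ ball ∘ tail)     ≡⟨ ∑-cong C (length-ball ∘ tail) ⟩
    ∑ C (λ _ → suc m)              ≡⟨ ∑-const C (suc m) ⟩
    length C * suc m               ≡⟨ cong (_* suc m) size ⟩
    M * suc m                      ≡⟨ packed ⟩
    2 ^ m                          ∎
    where open ≡-Reasoning

module ExtendedPerfectCode {m} {C : List (Word (suc m))}
  (far : AllPairs (λ u v → 4 ≤ dist u v) C) (0∈C : zeroWord (suc m) ∈ C)
  (tails-cover : ∀ q → ∃ λ c → c ∈ C × dist (tail c) q ≤ 1) where

  nearby : ℕ → Word (suc m) → ℕ
  nearby k s = ∑ (ofWeight k (suc m)) (λ d → 𝟙 ((s ⊕ d) ∈ᵇ C))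

  -- A codeword whose tail has weight at least three is at distance exactly four from the codeword
  -- covering its tail with two ones cleared, and the tail of that codeword is lighter.
  even-by-tail-weight : ∀ k b p → weight p < k → (b ∷ p) ∈ C → parity (b ∷ p) ≡ false
  even-by-tail-weight (suc k) b p p<k c∈C with weight p ≤? 2
  ... | yes light = trans (cong parity (close⇒≡ far c∈C 0∈C (s≤s (begin
          dist (b ∷ p) (zeroWord (suc m))  ≤⟨ dist-∷-≤ b false p (zeroWord m) ⟩
          suc (dist p (zeroWord m))        ≡⟨ cong suc (dist-zeroWordʳ p) ⟩
          suc (weight p)                   ≤⟨ s≤s light ⟩
          3                                ∎))))
        (parity-zeroWord (suc m))
    where open ≤-Reasoning
  ... | no heavy with m≤n⇒∃[o]m+o≡n (≰⇒> heavy)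
  ... | r , 3+r≡w with clearTwoBits p (sym 3+r≡w)
  ... | q , wq , p~q with tails-cover q
  ... | b' ∷ p' , c'∈C , p'~q =
    trans (even-dist⇒parity-≡ (b ∷ p) (b' ∷ p') (cong odd dist≡4)) (even-by-tail-weight k b' p' (≤-trans lighter (s≤s⁻¹ p<k)) c'∈C)
    where
    open ≤-Reasoning
    q~p' : dist q p' ≤ 1
    q~p' = subst (_≤ 1) (dist-sym p' q) p'~q
    lighter : weight p' < weight p
    lighter = begin-strict
      weight p'               ≤⟨ weight-≤-weight+dist q p' ⟩
      weight q + dist q p'    ≤⟨ +-mono-≤ (≤-reflexive wq) q~p' ⟩
      suc r + 1               ≡⟨ +-comm (suc r) 1 ⟩
      2 + r                   <⟨ ≤-refl ⟩
      3 + r                   ≡⟨ 3+r≡w ⟩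
      weight p                ∎
    near : dist p p' ≤ 3
    near = begin
      dist p p'               ≤⟨ dist-triangle p q p' ⟩
      dist p q + dist q p'    ≤⟨ +-mono-≤ p~q q~p' ⟩
      3                       ∎
    dist≡4 : dist (b ∷ p) (b' ∷ p') ≡ 4
    dist≡4 = dist-∷-≡ b b' p p' (distinct⇒far far c∈C c'∈C λ eq → <-irrefl (cong (weight ∘ tail) (sym eq)) lighter) near

  even : ∀ {c} → c ∈ C → parity c ≡ false
  even {b ∷ p} = even-by-tail-weight (suc (weight p)) b p ≤-refl

  nearby₂-member : ∀ {s} → s ∈ C → nearby 2 s ≡ 0
  nearby₂-member {s} s∈C = ∑-𝟙-none (ofWeight 2 (suc m)) _ λ {d} d∈ s⊕d∈ᵇC →
    let dist≡2 = trans (dist-⊕ʳ s d) (∈-ofWeight⁻ 2 (suc m) d∈)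
        s≡s⊕d = close⇒≡ far s∈C (∈ᵇ⇒∈ s⊕d∈ᵇC) (≤-trans (s≤s (≤-reflexive dist≡2)) (n≤1+n 3))
    in 0≢1+n (trans (sym (dist-self s)) (trans (cong (dist s) s≡s⊕d) dist≡2))

  nearby₁-odd : ∀ {s} → parity s ≡ true → nearby 1 s ≡ 1
  nearby₁-odd {b ∷ p} s-odd with tails-cover p
  ... | b' ∷ p' , c∈C , p'~p =
    ∑-𝟙-unique (λ d → (s ⊕ d) ∈ᵇ C) (ofWeight-distinct 1 (suc m)) d₀∈W₁
      (∈⇒∈ᵇ (subst (_∈ C) (sym (⊕-cancelˡ s c)) c∈C)) unique
    where
    s c : Word (suc m)
    s = b ∷ p
    c = b' ∷ p'
    dist≡1 : dist s c ≡ 1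
    dist≡1 = odd∧≤2⇒≡1 (trans (sym (parity-⊕≡odd∘dist s c)) (cong₂ _xor_ s-odd (even c∈C)))
                        (≤-trans (dist-∷-≤ b b' p p') (s≤s (subst (_≤ 1) (dist-sym p' p) p'~p)))
    d₀∈W₁ : s ⊕ c ∈ ofWeight 1 (suc m)
    d₀∈W₁ = subst (λ k → s ⊕ c ∈ ofWeight k (suc m)) dist≡1 (∈-ofWeight⁺ (s ⊕ c))
    unique : ∀ {d d'} → d ∈ ofWeight 1 (suc m) → d' ∈ ofWeight 1 (suc m) → T ((s ⊕ d) ∈ᵇ C) → T ((s ⊕ d') ∈ᵇ C) → d ≡ d'
    unique {d} {d'} d∈ d'∈ s⊕d∈ᵇC s⊕d'∈ᵇC = ⊕-injectiveʳ s (close⇒≡ far (∈ᵇ⇒∈ s⊕d∈ᵇC) (∈ᵇ⇒∈ s⊕d'∈ᵇC) (s≤s (begin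
      dist (s ⊕ d) (s ⊕ d')   ≡⟨ dist-⊕ˡ s d d' ⟩
      weight (d ⊕ d')         ≤⟨ weight-⊕-≤ d d' ⟩
      weight d + weight d'    ≡⟨ cong₂ _+_ (∈-ofWeight⁻ 1 (suc m) d∈) (∈-ofWeight⁻ 1 (suc m) d'∈) ⟩
      2                       <⟨ ≤-refl ⟩
      3                       ∎)))
      where open ≤-Reasoning

  -- Each of the suc m odd words s ⊕ u with u of weight one has exactly one codeword at distance one,
  -- and each codeword at distance two from s is found from exactly two such u.
  nearby₂-nonmember : ∀ {s} → parity s ≡ false → s ∉ C → 2 * nearby 2 s ≡ suc m
  nearby₂-nonmember {s} s-even s∉C = begin
    2 * nearby 2 s                                          ≡⟨ cong (_+ 2 * nearby 2 s) (*-zeroʳ (suc m)) ⟨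
    suc m * 0 + 2 * nearby 2 s                              ≡⟨ cong (λ t → suc m * t + 2 * nearby 2 s) s∉ᵇC ⟨
    suc m * 𝟙 ((s ⊕ zeroWord (suc m)) ∈ᵇ C) + 2 * nearby 2 s  ≡⟨ ∑-ofWeight₁-⊕ (suc m) (λ d → 𝟙 ((s ⊕ d) ∈ᵇ C)) ⟨
    ∑ W₁ (λ u → ∑ W₁ (λ u' → 𝟙 ((s ⊕ (u ⊕ u')) ∈ᵇ C)))       ≡⟨ ∑-cong W₁ (λ u → ∑-cong W₁ λ u' → cong (λ w → 𝟙 (w ∈ᵇ C)) (⊕-assoc s u u')) ⟨
    ∑ W₁ (λ u → nearby 1 (s ⊕ u))                           ≡⟨ ∑-cong-∈ W₁ (λ {u} u∈ → nearby₁-odd (trans (parity-⊕ s u) (cong₂ _xor_ s-even (parity-ofWeight u∈)))) ⟩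
    ∑ W₁ (λ _ → 1)                                           ≡⟨ ∑-const W₁ 1 ⟩
    length W₁ * 1                                            ≡⟨ *-identityʳ (length W₁) ⟩
    length W₁                                                ≡⟨ length-ofWeight₁ (suc m) ⟩
    suc m                                                    ∎
    where
    open ≡-Reasoning
    W₁ = ofWeight 1 (suc m)
    s∉ᵇC : 𝟙 ((s ⊕ zeroWord (suc m)) ∈ᵇ C) ≡ 0
    s∉ᵇC = 𝟙-¬T λ t → s∉C (subst (_∈ C) (⊕-identityʳ s) (∈ᵇ⇒∈ t))

-- The words of length 8 + 8 + 8

block₁ block₂ block₃ : Word 24 → Word 8
block₁ = take 8
block₂ = take 8 ∘ drop 8
block₃ = drop 8 ∘ drop 8

take-++ : ∀ {m n} (x : Word m) (y : Word n) → take m (x ++ y) ≡ x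
take-++ {m} x y = ++-injectiveˡ (take m (x ++ y)) x (take++drop≡id m (x ++ y))

drop-++ : ∀ {m n} (x : Word m) (y : Word n) → drop m (x ++ y) ≡ y
drop-++ {m} x y = ++-injectiveʳ (take m (x ++ y)) x (take++drop≡id m (x ++ y))

blocks-++ : ∀ (x y z : Word 8) → block₁ (x ++ y ++ z) ≡ x × block₂ (x ++ y ++ z) ≡ y × block₃ (x ++ y ++ z) ≡ z
blocks-++ x y z = take-++ x (y ++ z)
                , trans (cong (take 8) (drop-++ x (y ++ z))) (take-++ y z)
                , trans (cong (drop 8) (drop-++ x (y ++ z))) (drop-++ y z)

++-blocks : ∀ w → w ≡ block₁ w ++ block₂ w ++ block₃ w
++-blocks w = trans (sym (take++drop≡id 8 w)) (cong (block₁ w ++_) (sym (take++drop≡id 8 (drop 8 w))))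

block₁-⊕ : ∀ v e → block₁ (v ⊕ e) ≡ block₁ v ⊕ block₁ e
block₁-⊕ v e = take-zipWith {m = 8} _xor_ v e

block₂-⊕ : ∀ v e → block₂ (v ⊕ e) ≡ block₂ v ⊕ block₂ e
block₂-⊕ v e = trans (cong (take 8) (drop-zipWith {m = 8} _xor_ v e)) (take-zipWith {m = 8} _xor_ (drop 8 v) (drop 8 e))

block₃-⊕ : ∀ v e → block₃ (v ⊕ e) ≡ block₃ v ⊕ block₃ e
block₃-⊕ v e = trans (cong (drop 8) (drop-zipWith {m = 8} _xor_ v e)) (drop-zipWith {m = 8} _xor_ (drop 8 v) (drop 8 e))

∑₂-blocks : (Word 24 → ℕ) → ℕ
∑₂-blocks h =
  ∑∑ (ofWeight 2 8) (ofWeight 0 16) h +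
  (∑ (ofWeight 1 8) (λ x → ∑∑ (ofWeight 1 8) (ofWeight 0 8) (h ∘ (x ++_)) + ∑∑ (ofWeight 0 8) (ofWeight 1 8) (h ∘ (x ++_))) +
   ∑ (ofWeight 0 8) (λ x → ∑∑ (ofWeight 2 8) (ofWeight 0 8) (h ∘ (x ++_)) +
                           (∑∑ (ofWeight 1 8) (ofWeight 1 8) (h ∘ (x ++_)) + ∑∑ (ofWeight 0 8) (ofWeight 2 8) (h ∘ (x ++_)))))

∑-ofWeight₂-blocks : ∀ h → ∑ (ofWeight 2 24) h ≡ ∑₂-blocks h
∑-ofWeight₂-blocks h = trans (∑-ofWeight₂-++ 8 16 h) (cong (∑∑ (ofWeight 2 8) (ofWeight 0 16) h +_) (cong₂ _+_
  (∑-cong (ofWeight 1 8) (λ x → ∑-ofWeight₁-++ 8 8 (h ∘ (x ++_))))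
  (∑-cong (ofWeight 0 8) (λ x → ∑-ofWeight₂-++ 8 8 (h ∘ (x ++_))))))

module Colouring {B C : List (Word 8)} (B-code : IsCode 8 128 2 B) (0∈B : zeroWord 8 ∈ B)
                 (C-code : IsCode 8 16 4 C) (0∈C : zeroWord 8 ∈ C) where
  open EvenWeightCode B-code 0∈B
  open IsCode C-code using (distance)
  open ExtendedPerfectCode distance 0∈C (punctured-perfect C-code refl)

  χ : Word 24 → Bool
  χ w = not (parity (block₁ w)) ∧ (not (parity (block₂ w)) ∧ (block₂ w ⊕ block₃ w) ∈ᵇ C)

  χ-shifted : Bool → Bool → Word 8 → Word 24 → ℕ
  χ-shifted a b s e = 𝟙 (not (a xor parity (block₁ e)) ∧ (not (b xor parity (block₂ e)) ∧ (s ⊕ (block₂ e ⊕ block₃ e)) ∈ᵇ C))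

  χ-⊕ : ∀ v e → 𝟙 (χ (v ⊕ e)) ≡ χ-shifted (parity (block₁ v)) (parity (block₂ v)) (block₂ v ⊕ block₃ v) e
  χ-⊕ v e rewrite block₁-⊕ v e | block₂-⊕ v e | block₃-⊕ v e
                | parity-⊕ (block₁ v) (block₁ e) | parity-⊕ (block₂ v) (block₂ e)
                | ⊕-interchange (block₂ v) (block₂ e) (block₃ v) (block₃ e) = refl

  W₁ W₂ : List (Word 8)
  W₁ = ofWeight 1 8
  W₂ = ofWeight 2 8

  -- In the first step of each of the following evaluations the parities of the concrete blocks of e reduce,
  -- and only the membership tests (s ⊕ d) ∈ᵇ C remain.
  nbrs-odd-odd : ∀ s → parity s ≡ true → ∑₂-blocks (χ-shifted true true s) ≡ 8
  nbrs-odd-odd s s-odd = begin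
    ∑₂-blocks (χ-shifted true true s)                            ≡⟨⟩
    ∑ W₁ (λ _ → ∑ W₁ (λ d → 𝟙 ((s ⊕ d) ∈ᵇ C) + 0) + 0) + 0       ≡⟨ +-identityʳ _ ⟩
    ∑ W₁ (λ _ → ∑ W₁ (λ d → 𝟙 ((s ⊕ d) ∈ᵇ C) + 0) + 0)
      ≡⟨ ∑-cong W₁ {g = λ _ → 1} (λ _ → trans (+-identityʳ _) (trans (∑-cong W₁ {g = λ d → 𝟙 ((s ⊕ d) ∈ᵇ C)} λ _ → +-identityʳ _) (nearby₁-odd s-odd))) ⟩
    ∑ W₁ (λ _ → 1)                                               ≡⟨⟩
    8                                                            ∎
    where open ≡-Reasoning

  nbrs-odd-even : ∀ s → parity s ≡ true → ∑₂-blocks (χ-shifted true false s) ≡ 8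
  nbrs-odd-even s s-odd = begin
    ∑₂-blocks (χ-shifted true false s)                           ≡⟨⟩
    ∑ W₁ (λ _ → nearby 1 s + 0) + 0                              ≡⟨ +-identityʳ _ ⟩
    ∑ W₁ (λ _ → nearby 1 s + 0)                                  ≡⟨ ∑-cong W₁ {g = λ _ → 1} (λ _ → trans (+-identityʳ (nearby 1 s)) (nearby₁-odd s-odd)) ⟩
    ∑ W₁ (λ _ → 1)                                               ≡⟨⟩
    8                                                            ∎
    where open ≡-Reasoning

  nbrs-even-odd : ∀ s → parity s ≡ false → ∑₂-blocks (χ-shifted false true s) ≡ 8
  nbrs-even-odd s s-even = begin
    ∑₂-blocks (χ-shifted false true s)                           ≡⟨⟩
    (∑ W₁ (λ y → ∑ W₁ (λ z → 𝟙 ((s ⊕ (y ⊕ z)) ∈ᵇ C))) + 0) + 0   ≡⟨ trans (+-identityʳ _) (+-identityʳ _) ⟩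
    ∑ W₁ (λ y → ∑ W₁ (λ z → 𝟙 ((s ⊕ (y ⊕ z)) ∈ᵇ C)))
      ≡⟨ ∑-cong-∈ W₁ {f = λ y → ∑ W₁ (λ z → 𝟙 ((s ⊕ (y ⊕ z)) ∈ᵇ C))} {g = λ _ → 1} (λ {y} y∈ → trans (∑-cong W₁ {g = λ z → 𝟙 (((s ⊕ y) ⊕ z) ∈ᵇ C)} λ z → cong (λ w → 𝟙 (w ∈ᵇ C)) (sym (⊕-assoc s y z)))
                                       (nearby₁-odd (trans (parity-⊕ s y) (cong₂ _xor_ s-even (parity-ofWeight {1} {8} y∈))))) ⟩
    ∑ W₁ (λ _ → 1)                                               ≡⟨⟩
    8                                                            ∎
    where open ≡-Reasoning

  nbrs-even-even : ∀ s → ∑₂-blocks (χ-shifted false false s) ≡ 28 * 𝟙 (s ∈ᵇ C) + 2 * nearby 2 s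
  nbrs-even-even s = begin
    ∑₂-blocks (χ-shifted false false s)                          ≡⟨⟩
    ∑ W₂ (λ _ → 𝟙 ((s ⊕ zeroWord 8) ∈ᵇ C) + 0) + ((∑ W₂ (λ d → 𝟙 ((s ⊕ d) ∈ᵇ C) + 0) + (nearby 2 s + 0)) + 0)
      ≡⟨ cong₂ _+_ (∑-cong W₂ {g = λ _ → 𝟙 (s ∈ᵇ C)} λ _ → trans (+-identityʳ _) (cong (λ w → 𝟙 (w ∈ᵇ C)) (⊕-identityʳ s)))
                   (trans (+-identityʳ _) (cong₂ _+_ (∑-cong W₂ {g = λ d → 𝟙 ((s ⊕ d) ∈ᵇ C)} λ _ → +-identityʳ _) refl)) ⟩
    ∑ W₂ (λ _ → 𝟙 (s ∈ᵇ C)) + 2 * nearby 2 s                     ≡⟨ cong (_+ 2 * nearby 2 s) (∑-const W₂ (𝟙 (s ∈ᵇ C))) ⟩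
    28 * 𝟙 (s ∈ᵇ C) + 2 * nearby 2 s                             ∎
    where open ≡-Reasoning

  nbrs-shifted : ∀ a b s → parity s ≡ a → ∑₂-blocks (χ-shifted a b s) ≡ (if not a ∧ (not b ∧ s ∈ᵇ C) then 28 else 8)
  nbrs-shifted true true s s-odd = nbrs-odd-odd s s-odd
  nbrs-shifted true false s s-odd = nbrs-odd-even s s-odd
  nbrs-shifted false true s s-even = nbrs-even-odd s s-even
  nbrs-shifted false false s s-even with s ∈ᵇ C in s∈ᵇC
  ... | true = trans (nbrs-even-even s)
                     (cong₂ (λ b n → 28 * 𝟙 b + 2 * n) s∈ᵇC (nearby₂-member (∈ᵇ⇒∈ (subst T (sym s∈ᵇC) _))))
  ... | false = trans (nbrs-even-even s)
                      (cong₂ (λ b n → 28 * 𝟙 b + n) s∈ᵇC (nearby₂-nonmember s-even λ s∈C → subst T s∈ᵇC (∈⇒∈ᵇ s∈C)))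

  InL⇔χ : ∀ w → InL B C w ⇔ T (χ w)
  InL⇔χ w = mk⇔ to from
    where
    to : InL B C w → T (χ w)
    to (x , y , z , x∈B , y∈B , z∈C , refl) with blocks-++ x y (y ⊕ z)
    ... | b₁ , b₂ , b₃ rewrite b₁ | b₂ | b₃ | ∈⇒even x∈B | ∈⇒even y∈B | ⊕-cancelˡ y z = ∈⇒∈ᵇ z∈C
    from : T (χ w) → InL B C w
    from χw with Equivalence.to T-∧ χw
    ... | x-even , rest with Equivalence.to T-∧ rest
    ... | y-even , z∈ᵇC = block₁ w , block₂ w , block₂ w ⊕ block₃ w
                        , even⇒∈ (Equivalence.to T-not-≡ x-even) , even⇒∈ (Equivalence.to T-not-≡ y-even) , ∈ᵇ⇒∈ z∈ᵇC
                        , trans (++-blocks w) (cong (λ z → block₁ w ++ block₂ w ++ z) (sym (⊕-cancelˡ (block₂ w) (block₃ w))))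

  countNbrs-InL : (L? : Decidable (InL B C)) → ∀ v → IsVertex v → countNbrs (InL B C) L? v ≡ (if χ v then 28 else 8)
  countNbrs-InL L? v v-vertex = begin
    countNbrs (InL B C) L? v
      ≡⟨ countNbrs≡∑ (InL B C) L? χ (λ u → does-⇔ (InL⇔χ u) (L? u) (T? (χ u))) v v-vertex ⟩
    ∑ (ofWeight 2 24) (λ e → 𝟙 (χ (v ⊕ e)))       ≡⟨ ∑-cong (ofWeight 2 24) {f = λ e → 𝟙 (χ (v ⊕ e))} {g = χ-shifted a b s} (χ-⊕ v) ⟩
    ∑ (ofWeight 2 24) (χ-shifted a b s)          ≡⟨ ∑-ofWeight₂-blocks (χ-shifted a b s) ⟩
    ∑₂-blocks (χ-shifted a b s)                  ≡⟨ nbrs-shifted a b s s≡a ⟩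
    (if χ v then 28 else 8)                      ∎
    where
    open ≡-Reasoning
    a b : Bool
    a = parity (block₁ v)
    b = parity (block₂ v)
    s : Word 8
    s = block₂ v ⊕ block₃ v
    blocks-even : a xor (b xor parity (block₃ v)) ≡ false
    blocks-even = begin
      a xor (b xor parity (block₃ v))                    ≡⟨ cong (a xor_) (parity-++ (block₂ v) (block₃ v)) ⟨
      a xor parity (block₂ v ++ block₃ v)                ≡⟨ parity-++ (block₁ v) (block₂ v ++ block₃ v) ⟨
      parity (block₁ v ++ block₂ v ++ block₃ v)          ≡⟨ cong parity (++-blocks v) ⟨
      parity v                                           ≡⟨ IsVertex⇒even v v-vertex ⟩
      false                                              ∎
    s≡a : parity s ≡ a
    s≡a = trans (parity-⊕ (block₂ v) (block₃ v)) (sym (xor≡false⇒≡ blocks-even))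

  countNbrs-InL-and-complement : (L? : Decidable (InL B C)) → ∀ v → IsVertex v → ∀ k l → k + l ≡ 276 → (if χ v then 28 else 8) ≡ k →
                       countNbrs (InL B C) L? v ≡ k × countNbrs (λ u → ¬ InL B C u) (λ u → ¬? (L? u)) v ≡ l
  countNbrs-InL-and-complement L? v v-vertex k l k+l≡276 χ-count = inside , +-cancelˡ-≡ k outside l (begin
    k + outside          ≡⟨ cong (_+ outside) inside ⟨
    insideL + outside    ≡⟨ countNbrs-+-complement (InL B C) L? v v-vertex ⟩
    276                  ≡⟨ k+l≡276 ⟨
    k + l                ∎)
    where
    open ≡-Reasoning
    insideL outside : ℕ
    insideL = countNbrs (InL B C) L? v
    outside = countNbrs (λ u → ¬ InL B C u) (λ u → ¬? (L? u)) v
    inside : insideL ≡ k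
    inside = trans (countNbrs-InL L? v v-vertex) χ-count

lemma5 : (B C₈ : List (Word 8)) →
         IsCode 8 128 2 B → zeroWord 8 ∈ B →
         IsCode 8 16 4 C₈ → zeroWord 8 ∈ C₈ →
         (L? : Decidable (InL B C₈)) →
         PerfectColoring 24 (InL B C₈) L? 28 248 8 268
lemma5 B C₈ B-code 0∈B C-code 0∈C L? =
    (λ v v-vertex v∈L → countNbrs-InL-and-complement L? v v-vertex 28 248 refl
                          (cong (if_then 28 else 8) (dec-true (T? (χ v)) (Equivalence.to (InL⇔χ v) v∈L))))
  , (λ v v-vertex v∉L → countNbrs-InL-and-complement L? v v-vertex 8 268 refl
                          (cong (if_then 28 else 8) (dec-false (T? (χ v)) (v∉L ∘ Equivalence.from (InL⇔χ v)))))
  where open Colouring B-code 0∈B C-code 0∈C
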